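{- Let $n\ge 1$ and let $(\tau_\mu)$ be complex numbers indexed by the horizontal tableaux $\mu$ of shape $\mathbf{2\times n}$ such that $\sum_{\mu\perp\nu}\tau_\mu=0$ for every vertical tableau $\nu$ of shape $\mathbf{2\times n}$. Then for every integer $a$ with $n/2\le a\le n$, we have $\sum_{\mu\in T_a}\tau_\mu=0$, where $T_a$ is the set of horizontal tableaux of type $a$.
   Context: A horizontal tableau of shape $\mathbf{2\times n}$ is an unordered partition of $\{1,\dots,2n\}$ into two $n$-element sets (its rows). A vertical tableau of shape $\mathbf{2\times n}$ is a partition of $\{1,\dots,2n\}$ into $n$ two-element sets (its columns). A horizontal tableau $\mu$ and a vertical tableau $\nu$ are orthogonal, $\mu\perp\nu$, if every row of $\mu$ meets every column of $\nu$ in at most one element. For a horizontal tableau $\mu$, let $a_\mu\ge b_\mu$ be the numbers of elements of $\{1,\dots,n\}$ lying in the two rows of $\mu$ (so $a_\mu+b_\mu=n$); $\mu$ is said to be of type $a$ if $a_\mu=a$. -}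

module Defs where

open import Level using (Level)
open import Data.Bool using (Bool; true; false)
open import Data.Nat using (ℕ; zero; suc; _+_; _∸_; _⊔_)
open import Data.Nat.Properties using (_≟_)
open import Data.Fin using (Fin; toℕ)
open import Data.Fin.Properties using (all?)
open import Data.Fin.Subset using (Subset; _∈_; _∉_; ∣_∣)
open import Data.Fin.Subset.Properties using (_∈?_)
open import Data.Vec using (Vec; []; _∷_; take)
open import Data.List using (List; []; _∷_; _++_; map; foldr)
open import Data.Product using (Σ; _×_; _,_)
open import Relation.Nullary using (¬_; Dec; yes; no; ¬?; does)
open import Relation.Nullary.Decidable using (_×-dec_; _→-dec_)
open import Relation.Binary.PropositionalEquality using (_≡_; _≢_)
open import Algebra.Bundles using (CommutativeRing)

-- Scalars: a field of characteristic zero (ℂ is one; stdlib has no ℂ and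
-- no Field bundle).

ringNat : ∀ {c ℓ} (R : CommutativeRing c ℓ) → ℕ → CommutativeRing.Carrier R
ringNat R zero    = CommutativeRing.0# R
ringNat R (suc m) = CommutativeRing._+_ R (CommutativeRing.1# R) (ringNat R m)

record CharZeroField (c ℓ : Level) : Set (Level.suc (c Level.⊔ ℓ)) where
  field
    commRing : CommutativeRing c ℓ
  open CommutativeRing commRing public
  field
    nontrivial : ¬ (1# ≈ 0#)
    inverse    : ∀ x → ¬ (x ≈ 0#) → Σ Carrier (λ y → (x * y) ≈ 1#)
    charZero   : ∀ m → ringNat commRing m ≈ 0# → m ≡ 0

-- Tableaux of shape 2×n on the ground set Fin (n + n) = {1,…,2n}
-- (Fin index i stands for the element i+1).

-- A horizontal tableau {R, Rᶜ} is encoded canonically by the row R that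
-- contains the element 1 (index zero): |R| = n and 1 ∈ R.
IsHorizontal : (n : ℕ) → Subset (n + n) → Set
IsHorizontal n R = (∣ R ∣ ≡ n) × (∀ i → toℕ i ≡ 0 → i ∈ R)

-- A vertical tableau (partition into n two-element columns) is encoded
-- by the fixed-point-free involution x ↦ (other element of x's column).
record Vertical (n : ℕ) : Set where
  field
    partner    : Fin (n + n) → Fin (n + n)
    involutive : ∀ x → partner (partner x) ≡ x
    noFixed    : ∀ x → partner x ≢ x

-- μ = {R, Rᶜ} ⊥ ν: every row meets every column {x, partner x} in at most
-- one element, i.e. not both in R and not both in Rᶜ.
Orthogonal : (n : ℕ) → Subset (n + n) → Vertical n → Set
Orthogonal n R ν = ∀ x → ¬ ((x ∈ R) × (partner x ∈ R))
                       × ¬ ((x ∉ R) × (partner x ∉ R))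
  where open Vertical ν

-- a_μ = max(number of elements of {1..n} in R, in Rᶜ)
typeOf : (n : ℕ) → Subset (n + n) → ℕ
typeOf n R = ∣ take n R ∣ ⊔ (n ∸ ∣ take n R ∣)

HasType : (n : ℕ) → ℕ → Subset (n + n) → Set
HasType n a R = typeOf n R ≡ a

isHorizontal? : ∀ n R → Dec (IsHorizontal n R)
isHorizontal? n R = (∣ R ∣ ≟ n) ×-dec all? (λ i → (toℕ i ≟ 0) →-dec (i ∈? R))

orthogonal? : ∀ n R ν → Dec (Orthogonal n R ν)
orthogonal? n R ν = all? (λ x → ¬? ((x ∈? R) ×-dec (partner x ∈? R))
                           ×-dec ¬? (¬? (x ∈? R) ×-dec ¬? (partner x ∈? R)))
  where open Vertical ν

hasType? : ∀ n a R → Dec (HasType n a R)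
hasType? n a R = typeOf n R ≟ a

allSubsets : (m : ℕ) → List (Subset m)
allSubsets zero    = [] ∷ []
allSubsets (suc m) = map (true ∷_) (allSubsets m) ++ map (false ∷_) (allSubsets m)

module _ {c ℓ} (K : CharZeroField c ℓ) where
  open CharZeroField K using (Carrier; 0#) renaming (_+_ to _⊕_)

  sumWhere : ∀ {m p} {P : Subset m → Set p} → (∀ R → Dec (P R))
           → (Subset m → Carrier) → Carrier
  sumWhere {m} P? f =
    foldr (λ R acc → (if? (P? R) (f R)) ⊕ acc) 0# (allSubsets m)
    where
      if? : ∀ {q} {Q : Set q} → Dec Q → Carrier → Carrier
      if? (yes _) x = x
      if? (no  _) x = 0#

  sumOrth : ∀ n → (Subset (n + n) → Carrier) → Vertical n → Carrier
  sumOrth n τ ν = sumWhere (λ R → isHorizontal? n R ×-dec orthogonal? n R ν) τ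

  sumType : ∀ n → ℕ → (Subset (n + n) → Carrier) → Carrier
  sumType n a τ = sumWhere (λ R → isHorizontal? n R ×-dec hasType? n a R) τ

module Submission where

-- The orthogonality relations force τ to vanish on every horizontal tableau.
-- For lists M and L of pairs that together form a perfect matching, let F(M, L)
-- be the sum of τ over the horizontal R that separate every pair of M and split
-- all pairs of L the same way round. F(M, []) is an orthogonality relation, hence
-- 0, and F(M, [e]) = F(e ∷ M, []). For L = (a,b) ∷ (c,d) ∷ L′ let A, B, C be
-- F(M, ·) for the orientations (a,b)(c,d), (b,a)(c,d) and (d,a)(c,b). Moving the
-- pair {a,b}, {a,d} or {b,d} into M, after exchanging second entries, writes
-- A + B, A + C and B + C as F(M′, (c, _) ∷ L′), which vanish by induction; so
-- 2A = 0, and A = 0 in characteristic zero. Pairing the elements of a row R with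
-- those of its complement finally gives an L with F([], L) = τ_R, because the
-- complement of R misses 1 and so is not the canonical row of a tableau.

open import Defs
open import Level using (Level)
open import Data.Nat using (ℕ; _+_; _*_; _≤_)
open import Data.Fin.Subset using (Subset)

open import Data.Bool using (true; false; if_then_else_)
open import Data.Nat using (zero; suc; _∸_; _<_; s≤s; z≤n)
import Data.Nat.Properties as ℕ
open import Data.Nat.Tactic.RingSolver using (solve-∀)
open import Data.Fin using (Fin; zero; suc; toℕ; fromℕ<)
open import Data.Fin.Properties using (_≟_; toℕ-fromℕ<)
open import Data.Fin.Subset using (_∈_; _∉_; _⊆_; ∣_∣; ∁)
open import Data.Fin.Subset.Properties using (_∈?_; ⊆-antisym; x∈∁p⇒x∉p; ∣∁p∣≡n∸∣p∣)
import Data.Vec as Vec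
import Data.Vec.Properties as Vec
open import Data.List using (List; []; _∷_; _++_; map; foldr; zip; length)
open import Data.Nat.ListAction using (sum)
open import Data.List.Properties using (foldr-cong; foldr-map; length-map)
open import Data.List.Membership.Propositional using () renaming (_∈_ to _∈ᴸ_)
open import Data.List.Relation.Unary.All as All using (All; []; _∷_; all?)
open import Data.List.Relation.Unary.All.Properties using () renaming (map⁺ to All-map⁺)
open import Data.List.Relation.Unary.Any using (here; there)
open import Data.List.Relation.Unary.Any.Properties using (singleton⁻)
open import Data.Product using (Σ-syntax; _×_; _,_; proj₁; proj₂; swap)
open import Data.Sum as Sum using (_⊎_; inj₁; inj₂; [_,_]; [_,_]′)
open import Function using (_∘_; _$_; case_of_; _⇔_; mk⇔; Equivalence)
open import Relation.Nullary using (¬_; Dec; yes; no; does; ¬?; contradiction)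
open import Relation.Nullary.Decidable using (_×-dec_; _⊎-dec_)
open import Relation.Unary using (Decidable)
open import Relation.Binary.PropositionalEquality as ≡ using (_≡_; _≢_; cong; cong₂)
import Algebra.Properties.CommutativeSemigroup as CommutativeSemigroupProperties

private
  variable
    p q q′ : Level
    m : ℕ

module SubsetSums {c ℓ} (K : CharZeroField c ℓ) where
  open CharZeroField K renaming (_+_ to _⊕_)
  open import Relation.Binary.Reasoning.Setoid setoid
  open CommutativeSemigroupProperties +-commutativeSemigroup using (interchange)

  private
    variable
      x : Carrier
      P Q Q′ : Set p

  when : Dec P → Carrier → Carrier
  when (yes _) x = x
  when (no _)  _ = 0#

  when-yes : (d : Dec P) → P → when d x ≡ x
  when-yes (yes _) _ = ≡.refl
  when-yes (no ¬p) p = contradiction p ¬p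

  when-no : (d : Dec P) → ¬ P → when d x ≡ 0#
  when-no (yes p) ¬p = contradiction p ¬p
  when-no (no _)  _  = ≡.refl

  when-cong : (d : Dec P) (e : Dec Q) → P ⇔ Q → when d x ≡ when e x
  when-cong (yes p) e P⇔Q = ≡.sym (when-yes e (Equivalence.to P⇔Q p))
  when-cong (no ¬p) e P⇔Q = ≡.sym (when-no e (¬p ∘ Equivalence.from P⇔Q))

  when-⊎ : (d : Dec P) (e : Dec Q) (e′ : Dec Q′) → P ⇔ (Q ⊎ Q′) → (Q → ¬ Q′) →
           when d x ≈ when e x ⊕ when e′ x
  when-⊎ d (yes q) (yes q′) _ disjoint = contradiction q′ (disjoint q)
  when-⊎ {x = x} d (yes q) (no _) P⇔Q⊎Q′ _ = begin
    when d x ≡⟨ when-yes d (Equivalence.from P⇔Q⊎Q′ (inj₁ q)) ⟩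
    x        ≈⟨ sym (+-identityʳ x) ⟩
    x ⊕ 0#   ∎
  when-⊎ {x = x} d (no _) (yes q′) P⇔Q⊎Q′ _ = begin
    when d x ≡⟨ when-yes d (Equivalence.from P⇔Q⊎Q′ (inj₂ q′)) ⟩
    x        ≈⟨ sym (+-identityˡ x) ⟩
    0# ⊕ x   ∎
  when-⊎ {x = x} d (no ¬q) (no ¬q′) P⇔Q⊎Q′ _ = begin
    when d x ≡⟨ when-no d ([ ¬q , ¬q′ ] ∘ Equivalence.to P⇔Q⊎Q′) ⟩
    0#       ≈⟨ sym (+-identityʳ 0#) ⟩
    0# ⊕ 0#  ∎

  sumOver : List (Subset m) → (Subset m → Carrier) → Carrier
  sumOver Rs g = foldr (λ R → g R ⊕_) 0# Rs

  sumOver-cong : ∀ {g h : Subset m → Carrier} (Rs : List (Subset m)) →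
                 (∀ R → g R ≈ h R) → sumOver Rs g ≈ sumOver Rs h
  sumOver-cong []       g≈h = refl
  sumOver-cong (R ∷ Rs) g≈h = +-cong (g≈h R) (sumOver-cong Rs g≈h)

  sumOver-zero : ∀ {g : Subset m → Carrier} (Rs : List (Subset m)) →
                 (∀ R → g R ≈ 0#) → sumOver Rs g ≈ 0#
  sumOver-zero []       g≈0 = refl
  sumOver-zero (R ∷ Rs) g≈0 = trans (+-cong (g≈0 R) (sumOver-zero Rs g≈0)) (+-identityʳ 0#)

  sumOver-⊕ : ∀ {g h : Subset m → Carrier} (Rs : List (Subset m)) →
              sumOver Rs (λ R → g R ⊕ h R) ≈ sumOver Rs g ⊕ sumOver Rs h
  sumOver-⊕ []               = sym (+-identityʳ 0#)
  sumOver-⊕ {g = g} {h} (R ∷ Rs) =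
    trans (+-congˡ (sumOver-⊕ Rs)) (interchange (g R) (h R) _ _)

  sumOver-++ : ∀ {g : Subset m → Carrier} (Rs Rs′ : List (Subset m)) →
               sumOver (Rs ++ Rs′) g ≈ sumOver Rs g ⊕ sumOver Rs′ g
  sumOver-++ []       Rs′ = sym (+-identityˡ _)
  sumOver-++ (R ∷ Rs) Rs′ = trans (+-congˡ (sumOver-++ Rs Rs′)) (sym (+-assoc _ _ _))

  sumOver-allSubsets-single : ∀ m {g : Subset m → Carrier} (R₀ : Subset m) →
                              (∀ R → R ≢ R₀ → g R ≈ 0#) →
                              sumOver (allSubsets m) g ≈ g R₀
  sumOver-allSubsets-single zero Vec.[] _ = +-identityʳ _
  sumOver-allSubsets-single (suc m) {g} (b Vec.∷ R₀) g≈0 = begin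
    sumOver (map (true Vec.∷_) Rs ++ map (false Vec.∷_) Rs) g
      ≈⟨ sumOver-++ (map (true Vec.∷_) Rs) _ ⟩
    sumOver (map (true Vec.∷_) Rs) g ⊕ sumOver (map (false Vec.∷_) Rs) g
      ≡⟨ ≡.cong₂ _⊕_ (foldr-map _ (true Vec.∷_) 0# Rs) (foldr-map _ (false Vec.∷_) 0# Rs) ⟩
    sumOver Rs (g ∘ (true Vec.∷_)) ⊕ sumOver Rs (g ∘ (false Vec.∷_))
      ≈⟨ halves b g≈0 ⟩
    g (b Vec.∷ R₀) ∎
    where
    Rs : List (Subset m)
    Rs = allSubsets m
    tail≢ : ∀ {b b′ R} → R ≢ R₀ → b′ Vec.∷ R ≢ b Vec.∷ R₀
    tail≢ R≢R₀ = R≢R₀ ∘ Vec.∷-injectiveʳ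
    halves : ∀ b → (∀ R → R ≢ b Vec.∷ R₀ → g R ≈ 0#) →
             sumOver Rs (g ∘ (true Vec.∷_)) ⊕ sumOver Rs (g ∘ (false Vec.∷_)) ≈ g (b Vec.∷ R₀)
    halves true g≈0 = trans
      (+-cong (sumOver-allSubsets-single m R₀ (λ R → g≈0 _ ∘ tail≢))
              (sumOver-zero Rs (λ R → g≈0 _ λ ())))
      (+-identityʳ _)
    halves false g≈0 = trans
      (+-cong (sumOver-zero Rs (λ R → g≈0 _ λ ()))
              (sumOver-allSubsets-single m R₀ (λ R → g≈0 _ ∘ tail≢)))
      (+-identityˡ _)

  -- The summand of sumWhere is local to Defs, so it can only be reached
  -- by unification and then evaluated by case analysis on the decision.
  private
    sumWhere-foldr : ∀ {P : Subset m → Set p} (P? : Decidable P) f →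
                     Σ[ step ∈ (Subset m → Carrier → Carrier) ]
                       sumWhere K P? f ≡ foldr step 0# (allSubsets m)
    sumWhere-foldr P? f = _ , ≡.refl

    sumWhere-step : ∀ {P : Subset m → Set p} (P? : Decidable P) f R y →
                    proj₁ (sumWhere-foldr P? f) R y ≡ when (P? R) (f R) ⊕ y
    sumWhere-step P? f R y with P? R
    ... | yes _ = ≡.refl
    ... | no _  = ≡.refl

  sumWhere-sumOver : ∀ {P : Subset m → Set p} (P? : Decidable P) f →
                     sumWhere K P? f ≡ sumOver (allSubsets m) (λ R → when (P? R) (f R))
  sumWhere-sumOver {m} P? f =
    ≡.trans (proj₂ (sumWhere-foldr P? f)) (foldr-cong (sumWhere-step P? f) ≡.refl (allSubsets m))

  module _ {P : Subset m → Set p} (P? : Decidable P) (f : Subset m → Carrier) where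

    sumWhere-cong : ∀ {Q : Subset m → Set q} (Q? : Decidable Q) →
                    (∀ R → P R ⇔ Q R) → sumWhere K P? f ≡ sumWhere K Q? f
    sumWhere-cong Q? P⇔Q = ≡.trans (sumWhere-sumOver P? f) $ ≡.trans
      (foldr-cong (λ R y → cong (_⊕ y) (when-cong (P? R) (Q? R) (P⇔Q R))) ≡.refl (allSubsets m))
      (≡.sym (sumWhere-sumOver Q? f))

    sumWhere-⊎ : ∀ {Q : Subset m → Set q} {Q′ : Subset m → Set q′}
                 (Q? : Decidable Q) (Q′? : Decidable Q′) →
                 (∀ R → P R ⇔ (Q R ⊎ Q′ R)) → (∀ R → Q R → ¬ Q′ R) →
                 sumWhere K P? f ≈ sumWhere K Q? f ⊕ sumWhere K Q′? f
    sumWhere-⊎ Q? Q′? P⇔Q⊎Q′ disjoint = begin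
      sumWhere K P? f
        ≡⟨ sumWhere-sumOver P? f ⟩
      sumOver (allSubsets m) (λ R → when (P? R) (f R))
        ≈⟨ sumOver-cong (allSubsets m) (λ R →
             when-⊎ (P? R) (Q? R) (Q′? R) (P⇔Q⊎Q′ R) (disjoint R)) ⟩
      sumOver (allSubsets m) (λ R → when (Q? R) (f R) ⊕ when (Q′? R) (f R))
        ≈⟨ sumOver-⊕ (allSubsets m) ⟩
      sumOver (allSubsets m) (λ R → when (Q? R) (f R)) ⊕
      sumOver (allSubsets m) (λ R → when (Q′? R) (f R))
        ≡⟨ ≡.sym (≡.cong₂ _⊕_ (sumWhere-sumOver Q? f) (sumWhere-sumOver Q′? f)) ⟩
      sumWhere K Q? f ⊕ sumWhere K Q′? f ∎

    sumWhere-zero : (∀ R → P R → f R ≈ 0#) → sumWhere K P? f ≈ 0#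
    sumWhere-zero f≈0 = trans (reflexive (sumWhere-sumOver P? f)) (sumOver-zero (allSubsets m) when≈0)
      where
      when≈0 : ∀ R → when (P? R) (f R) ≈ 0#
      when≈0 R with P? R
      ... | yes p = f≈0 R p
      ... | no _  = refl

    sumWhere-single : ∀ R₀ → (∀ R → P R ⇔ R ≡ R₀) → sumWhere K P? f ≈ f R₀
    sumWhere-single R₀ P⇔≡R₀ = begin
      sumWhere K P? f
        ≡⟨ sumWhere-sumOver P? f ⟩
      sumOver (allSubsets m) (λ R → when (P? R) (f R))
        ≈⟨ sumOver-allSubsets-single m R₀ when≈0 ⟩
      when (P? R₀) (f R₀)
        ≡⟨ when-yes (P? R₀) (Equivalence.from (P⇔≡R₀ R₀) ≡.refl) ⟩
      f R₀ ∎
      where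
      when≈0 : ∀ R → R ≢ R₀ → when (P? R) (f R) ≈ 0#
      when≈0 R R≢R₀ = reflexive (when-no (P? R) (R≢R₀ ∘ Equivalence.to (P⇔≡R₀ R)))

module CharZeroFieldProperties {c ℓ} (K : CharZeroField c ℓ) where
  open CharZeroField K renaming (_+_ to _⊕_; _*_ to _⊛_)
  open import Relation.Binary.Reasoning.Setoid setoid
  open CommutativeSemigroupProperties +-commutativeSemigroup using (interchange)

  private
    variable
      x : Carrier

  2*x≈x+x : ∀ x → ringNat commRing 2 ⊛ x ≈ x ⊕ x
  2*x≈x+x x = begin
    (1# ⊕ (1# ⊕ 0#)) ⊛ x      ≈⟨ distribʳ x 1# (1# ⊕ 0#) ⟩
    1# ⊛ x ⊕ (1# ⊕ 0#) ⊛ x    ≈⟨ +-congˡ (*-congʳ (+-identityʳ 1#)) ⟩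
    1# ⊛ x ⊕ 1# ⊛ x           ≈⟨ +-cong (*-identityˡ x) (*-identityˡ x) ⟩
    x ⊕ x                     ∎

  x+x≈0⇒x≈0 : x ⊕ x ≈ 0# → x ≈ 0#
  x+x≈0⇒x≈0 {x} x+x≈0 = begin
    x                ≈⟨ sym (*-identityˡ x) ⟩
    1# ⊛ x           ≈⟨ *-congʳ (sym 2⊛½≈1) ⟩
    (2# ⊛ ½) ⊛ x     ≈⟨ *-congʳ (*-comm 2# ½) ⟩
    (½ ⊛ 2#) ⊛ x     ≈⟨ *-assoc ½ 2# x ⟩
    ½ ⊛ (2# ⊛ x)     ≈⟨ *-congˡ (2*x≈x+x x) ⟩
    ½ ⊛ (x ⊕ x)      ≈⟨ *-congˡ x+x≈0 ⟩
    ½ ⊛ 0#           ≈⟨ zeroʳ ½ ⟩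
    0#               ∎
    where
    2# : Carrier
    2# = ringNat commRing 2
    ½-spec : Σ[ y ∈ Carrier ] 2# ⊛ y ≈ 1#
    ½-spec = inverse 2# (λ 2≈0 → case charZero 2 2≈0 of λ ())
    ½ : Carrier
    ½ = proj₁ ½-spec
    2⊛½≈1 : 2# ⊛ ½ ≈ 1#
    2⊛½≈1 = proj₂ ½-spec

  pairwise-sums≈0⇒≈0 : ∀ x y z → x ⊕ y ≈ 0# → x ⊕ z ≈ 0# → y ⊕ z ≈ 0# → x ≈ 0#
  pairwise-sums≈0⇒≈0 x y z x+y≈0 x+z≈0 y+z≈0 = x+x≈0⇒x≈0 $ begin
    x ⊕ x               ≈⟨ sym (+-identityʳ _) ⟩
    (x ⊕ x) ⊕ 0#        ≈⟨ +-congˡ (sym y+z≈0) ⟩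
    (x ⊕ x) ⊕ (y ⊕ z)   ≈⟨ interchange x x y z ⟩
    (x ⊕ y) ⊕ (x ⊕ z)   ≈⟨ +-cong x+y≈0 x+z≈0 ⟩
    0# ⊕ 0#             ≈⟨ +-identityʳ 0# ⟩
    0#                  ∎

Edge : ℕ → Set
Edge m = Fin m × Fin m

private
  variable
    x y u v w z : Fin m
    G L M : List (Edge m)
    R R′ : Subset m

δ : Fin m → Fin m → ℕ
δ z x = if does (z ≟ x) then 1 else 0

occurrences : Fin m → List (Fin m) → ℕ
occurrences z = sum ∘ map (δ z)

endpoints : List (Edge m) → List (Fin m)
endpoints []            = []
endpoints ((x , y) ∷ G) = x ∷ y ∷ endpoints G

degree : Fin m → List (Edge m) → ℕ
degree z = occurrences z ∘ endpoints

IsPerfectMatching : List (Edge m) → Set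
IsPerfectMatching G = ∀ z → degree z G ≡ 1

degree-regroup : ∀ z (e : Edge m) M L → degree z (e ∷ M) + degree z L ≡ degree z M + degree z (e ∷ L)
degree-regroup z (x , y) M L = regroup (δ z x) (δ z y) (degree z M) (degree z L)
  where
  regroup : ∀ x y m l → (x + (y + m)) + l ≡ m + (x + (y + l))
  regroup = solve-∀

degree-cross : ∀ z (x y u v : Fin m) L →
               degree z ((x , y) ∷ (u , v) ∷ L) ≡ degree z ((x , v) ∷ (u , y) ∷ L)
degree-cross z x y u v L = cross (δ z x) (δ z y) (δ z u) (δ z v) (degree z L)
  where
  cross : ∀ x y u v l → x + (y + (u + (v + l))) ≡ x + (v + (u + (y + l)))
  cross = solve-∀

degree-flip : ∀ z (x y : Fin m) L → degree z ((x , y) ∷ L) ≡ degree z ((y , x) ∷ L)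
degree-flip z x y L = flip (δ z x) (δ z y) (degree z L)
  where
  flip : ∀ x y l → x + (y + l) ≡ y + (x + l)
  flip = solve-∀

neighbours : Fin m → List (Edge m) → List (Fin m)
neighbours z [] = []
neighbours z ((x , y) ∷ G) with z ≟ x | z ≟ y
... | yes _ | yes _ = y ∷ x ∷ neighbours z G
... | yes _ | no _  = y ∷ neighbours z G
... | no _  | yes _ = x ∷ neighbours z G
... | no _  | no _  = neighbours z G

Adjacent : List (Edge m) → Fin m → Fin m → Set
Adjacent G z w = (z , w) ∈ᴸ G ⊎ (w , z) ∈ᴸ G

length-neighbours : ∀ z (G : List (Edge m)) → length (neighbours z G) ≡ degree z G
length-neighbours z [] = ≡.refl
length-neighbours z ((x , y) ∷ G) with z ≟ x | z ≟ y
... | yes _ | yes _ = cong (2 +_) (length-neighbours z G)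
... | yes _ | no _  = cong (1 +_) (length-neighbours z G)
... | no _  | yes _ = cong (1 +_) (length-neighbours z G)
... | no _  | no _  = length-neighbours z G

∈-neighbours⁻ : w ∈ᴸ neighbours z G → Adjacent G z w
∈-neighbours⁻ {z = z} {G = (x , y) ∷ G} w∈N with z ≟ x | z ≟ y | w∈N
... | yes ≡.refl | yes _      | here ≡.refl         = inj₁ (here ≡.refl)
... | yes _      | yes ≡.refl | there (here ≡.refl) = inj₂ (here ≡.refl)
... | yes _      | yes _      | there (there w∈N′)  = Sum.map there there (∈-neighbours⁻ w∈N′)
... | yes ≡.refl | no _       | here ≡.refl         = inj₁ (here ≡.refl)
... | yes _      | no _       | there w∈N′          = Sum.map there there (∈-neighbours⁻ w∈N′)
... | no _       | yes ≡.refl | here ≡.refl         = inj₂ (here ≡.refl)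
... | no _       | yes _      | there w∈N′          = Sum.map there there (∈-neighbours⁻ w∈N′)
... | no _       | no _       | w∈N′                = Sum.map there there (∈-neighbours⁻ w∈N′)

neighbours-∷ : ∀ e → w ∈ᴸ neighbours z G → w ∈ᴸ neighbours z (e ∷ G)
neighbours-∷ {z = z} (x , y) w∈N with z ≟ x | z ≟ y
... | yes _ | yes _ = there (there w∈N)
... | yes _ | no _  = there w∈N
... | no _  | yes _ = there w∈N
... | no _  | no _  = w∈N

∈-neighbours⁺ : Adjacent G z w → w ∈ᴸ neighbours z G
∈-neighbours⁺ {G = (x , y) ∷ G} (inj₁ (here ≡.refl)) with x ≟ x | x ≟ y
... | yes _ | yes _ = here ≡.refl
... | yes _ | no _  = here ≡.refl
... | no x≢x | _    = contradiction ≡.refl x≢x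
∈-neighbours⁺ {G = (x , y) ∷ G} (inj₂ (here ≡.refl)) with y ≟ x | y ≟ y
... | yes _ | yes _  = there (here ≡.refl)
... | no _  | yes _  = here ≡.refl
... | _     | no y≢y = contradiction ≡.refl y≢y
∈-neighbours⁺ {G = e ∷ G} {z = z} (inj₁ (there zw∈G)) =
  neighbours-∷ {z = z} {G} e (∈-neighbours⁺ (inj₁ zw∈G))
∈-neighbours⁺ {G = e ∷ G} {z = z} (inj₂ (there wz∈G)) =
  neighbours-∷ {z = z} {G} e (∈-neighbours⁺ (inj₂ wz∈G))

δ-refl : ∀ (z : Fin m) → δ z z ≡ 1
δ-refl z with z ≟ z
... | yes _   = ≡.refl
... | no z≢z = contradiction ≡.refl z≢z

loop⇒1<degree : (z , z) ∈ᴸ G → 1 < degree z G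
loop⇒1<degree {z = z} {G = (z , z) ∷ G} (here ≡.refl)
  rewrite δ-refl z = s≤s (s≤s z≤n)
loop⇒1<degree {z = z} {G = (x , y) ∷ G} (there zz∈G) =
  ℕ.≤-trans (loop⇒1<degree zz∈G) (ℕ.≤-trans (ℕ.m≤n+m _ (δ z y)) (ℕ.m≤n+m _ (δ z x)))

length≡1⇒singleton : ∀ {a} {A : Set a} (xs : List A) → length xs ≡ 1 → Σ[ x ∈ A ] xs ≡ x ∷ []
length≡1⇒singleton (x ∷ []) _ = x , ≡.refl

module PerfectMatching (G : List (Edge m)) (perfect : IsPerfectMatching G) where

  private
    neighbour : ∀ z → Σ[ w ∈ Fin m ] neighbours z G ≡ w ∷ []
    neighbour z = length≡1⇒singleton (neighbours z G) (≡.trans (length-neighbours z G) (perfect z))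

  partner : Fin m → Fin m
  partner = proj₁ ∘ neighbour

  adjacent-partner : ∀ z → Adjacent G z (partner z)
  adjacent-partner z =
    ∈-neighbours⁻ (≡.subst (partner z ∈ᴸ_) (≡.sym (proj₂ (neighbour z))) (here ≡.refl))

  adjacent⇒≡partner : Adjacent G z w → w ≡ partner z
  adjacent⇒≡partner {z} {w} adj =
    singleton⁻ (≡.subst (w ∈ᴸ_) (proj₂ (neighbour z)) (∈-neighbours⁺ adj))

  partner-involutive : ∀ z → partner (partner z) ≡ z
  partner-involutive z = ≡.sym (adjacent⇒≡partner (Sum.swap (adjacent-partner z)))

  partner-fixed-point-free : ∀ z → partner z ≢ z
  partner-fixed-point-free z pz≡z =
    [ no-loop , no-loop ] (≡.subst (Adjacent G z) pz≡z (adjacent-partner z))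
    where
    no-loop : ¬ (z , z) ∈ᴸ G
    no-loop zz∈G = ℕ.<-irrefl ≡.refl (≡.subst (1 <_) (perfect z) (loop⇒1<degree zz∈G))

toVertical : ∀ {n} (G : List (Edge (n + n))) → IsPerfectMatching G → Vertical n
toVertical G perfect = record
  { partner    = partner
  ; involutive = partner-involutive
  ; noFixed    = partner-fixed-point-free
  }
  where open PerfectMatching G perfect

Separates : Subset m → Edge m → Set
Separates R (x , y) = ¬ (x ∈ R × y ∈ R) × ¬ (x ∉ R × y ∉ R)

Oriented : Subset m → Edge m → Set
Oriented R (x , y) = x ∈ R × y ∉ R

Coherent : Subset m → List (Edge m) → Set
Coherent R L = All (Oriented R) L ⊎ All (Oriented R ∘ swap) L

separates? : ∀ R (e : Edge m) → Dec (Separates R e)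
separates? R (x , y) = ¬? (x ∈? R ×-dec y ∈? R) ×-dec ¬? (¬? (x ∈? R) ×-dec ¬? (y ∈? R))

oriented? : ∀ R (e : Edge m) → Dec (Oriented R e)
oriented? R (x , y) = x ∈? R ×-dec ¬? (y ∈? R)

coherent? : ∀ R (L : List (Edge m)) → Dec (Coherent R L)
coherent? R L = all? (oriented? R) L ⊎-dec all? (oriented? R ∘ swap) L

separates-sym : Separates R (x , y) → Separates R (y , x)
separates-sym (¬both∈ , ¬both∉) = ¬both∈ ∘ swap , ¬both∉ ∘ swap

oriented⇒separates : Oriented R (x , y) → Separates R (x , y)
oriented⇒separates (x∈R , y∉R) = (λ (_ , y∈R) → y∉R y∈R) , (λ (x∉R , _) → x∉R x∈R)

separates⇒oriented : Separates R (x , y) → Oriented R (x , y) ⊎ Oriented R (y , x)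
separates⇒oriented {R = R} {x} {y} (¬both∈ , ¬both∉) with x ∈? R | y ∈? R
... | yes x∈R | yes y∈R = contradiction (x∈R , y∈R) ¬both∈
... | yes x∈R | no y∉R  = inj₁ (x∈R , y∉R)
... | no x∉R  | yes y∈R = inj₂ (y∈R , x∉R)
... | no x∉R  | no y∉R  = contradiction (x∉R , y∉R) ¬both∉

coherent-[-]⇔separates : ∀ (e : Edge m) → Coherent R (e ∷ []) ⇔ Separates R e
coherent-[-]⇔separates e = mk⇔
  [ (λ { (o ∷ []) → oriented⇒separates o })
  , (λ { (o ∷ []) → separates-sym (oriented⇒separates o) })
  ]
  (Sum.map (_∷ []) (_∷ []) ∘ separates⇒oriented)

separates-coherent : Separates R (x , y) → Coherent R L →
                     Coherent R ((x , y) ∷ L) ⊎ Coherent R ((y , x) ∷ L)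
separates-coherent s c with separates⇒oriented s | c
... | inj₁ o | inj₁ os = inj₁ (inj₁ (o ∷ os))
... | inj₁ o | inj₂ os = inj₂ (inj₂ (o ∷ os))
... | inj₂ o | inj₁ os = inj₂ (inj₁ (o ∷ os))
... | inj₂ o | inj₂ os = inj₁ (inj₂ (o ∷ os))

coherent-∷⁻ : Coherent R ((x , y) ∷ L) → Separates R (x , y) × Coherent R L
coherent-∷⁻ (inj₁ (o ∷ os)) = oriented⇒separates o , inj₁ os
coherent-∷⁻ (inj₂ (o ∷ os)) = separates-sym (oriented⇒separates o) , inj₂ os

coherent-flip-disjoint : ∀ e → Coherent R ((x , y) ∷ e ∷ L) → ¬ Coherent R ((y , x) ∷ e ∷ L)
coherent-flip-disjoint e (inj₁ ((x∈R , _) ∷ _))  (inj₁ ((_ , x∉R) ∷ _))  = x∉R x∈R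
coherent-flip-disjoint e (inj₁ (_ ∷ (u∈R , _) ∷ _)) (inj₂ (_ ∷ (_ , u∉R) ∷ _)) = u∉R u∈R
coherent-flip-disjoint e (inj₂ (_ ∷ (_ , u∉R) ∷ _)) (inj₁ (_ ∷ (u∈R , _) ∷ _)) = u∉R u∈R
coherent-flip-disjoint e (inj₂ ((_ , x∉R) ∷ _))  (inj₂ ((x∈R , _) ∷ _))  = x∉R x∈R

coherent-cross : Coherent R ((x , y) ∷ (u , v) ∷ L) → Coherent R ((x , v) ∷ (u , y) ∷ L)
coherent-cross (inj₁ ((x∈R , y∉R) ∷ (u∈R , v∉R) ∷ os)) =
  inj₁ ((x∈R , v∉R) ∷ (u∈R , y∉R) ∷ os)
coherent-cross (inj₂ ((y∈R , x∉R) ∷ (v∈R , u∉R) ∷ os)) =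
  inj₂ ((v∈R , x∉R) ∷ (y∈R , u∉R) ∷ os)

orthogonal⇔separates : ∀ {n} (G : List (Edge (n + n))) (perfect : IsPerfectMatching G) R →
                       Orthogonal n R (toVertical G perfect) ⇔ All (Separates R) G
orthogonal⇔separates G perfect R = mk⇔
  (λ orth → All.tabulate λ {(x , y)} xy∈G →
     ≡.subst (Separates R ∘ (x ,_)) (≡.sym (adjacent⇒≡partner (inj₁ xy∈G))) (orth x))
  (λ seps x → [ All.lookup seps , separates-sym ∘ All.lookup seps ]′ (adjacent-partner x))
  where open PerfectMatching G perfect

oriented-⊆ : (∀ z → Σ[ w ∈ Fin m ] Adjacent G z w) →
             All (Oriented R) G → All (Oriented R′) G → R ⊆ R′
oriented-⊆ spanning oriented oriented′ {z} z∈R with spanning z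
... | w , inj₁ zw∈G = proj₁ (All.lookup oriented′ zw∈G)
... | w , inj₂ wz∈G = contradiction z∈R (proj₂ (All.lookup oriented wz∈G))

oriented-opposite : Adjacent G z w → All (Oriented R) G → All (Oriented R′ ∘ swap) G →
                    z ∈ R → z ∉ R′
oriented-opposite (inj₁ zw∈G) _        oriented′ _   = proj₂ (All.lookup oriented′ zw∈G)
oriented-opposite (inj₂ wz∈G) oriented _         z∈R =
  contradiction z∈R (proj₂ (All.lookup oriented wz∈G))

members : Subset m → List (Fin m)
members Vec.[]          = []
members (true Vec.∷ R)  = zero ∷ map suc (members R)
members (false Vec.∷ R) = map suc (members R)

private
  variable
    xs ys : List (Fin m)

occurrences-suc : ∀ (z : Fin m) xs → occurrences (suc z) (map suc xs) ≡ occurrences z xs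
occurrences-suc z []       = ≡.refl
occurrences-suc z (x ∷ xs) = cong (δ z x +_) (occurrences-suc z xs)

occurrences-zero : ∀ (xs : List (Fin m)) → occurrences zero (map suc xs) ≡ 0
occurrences-zero []       = ≡.refl
occurrences-zero (x ∷ xs) = occurrences-zero xs

occurrences-members : ∀ (R : Subset m) z → occurrences z (members R) + occurrences z (members (∁ R)) ≡ 1
occurrences-members (true Vec.∷ R) zero =
  cong₂ (λ i o → 1 + i + o) (occurrences-zero (members R)) (occurrences-zero (members (∁ R)))
occurrences-members (false Vec.∷ R) zero =
  cong₂ (λ i o → i + (1 + o)) (occurrences-zero (members R)) (occurrences-zero (members (∁ R)))
occurrences-members (true Vec.∷ R) (suc z) =
  ≡.trans (cong₂ _+_ (occurrences-suc z (members R)) (occurrences-suc z (members (∁ R))))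
          (occurrences-members R z)
occurrences-members (false Vec.∷ R) (suc z) =
  ≡.trans (cong₂ _+_ (occurrences-suc z (members R)) (occurrences-suc z (members (∁ R))))
          (occurrences-members R z)

length-members : ∀ (R : Subset m) → length (members R) ≡ ∣ R ∣
length-members Vec.[]          = ≡.refl
length-members (true Vec.∷ R)  = cong (1 +_) (≡.trans (length-map suc (members R)) (length-members R))
length-members (false Vec.∷ R) = ≡.trans (length-map suc (members R)) (length-members R)

members-⊆ : ∀ (R : Subset m) → All (_∈ R) (members R)
members-⊆ Vec.[]          = []
members-⊆ (true Vec.∷ R)  = Vec.here ∷ All-map⁺ (All.map Vec.there (members-⊆ R))
members-⊆ (false Vec.∷ R) = All-map⁺ (All.map Vec.there (members-⊆ R))

degree-zip : ∀ z (xs ys : List (Fin m)) → length xs ≡ length ys →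
             degree z (zip xs ys) ≡ occurrences z xs + occurrences z ys
degree-zip z []       []       _ = ≡.refl
degree-zip z (x ∷ xs) (y ∷ ys) |xs|≡|ys| =
  ≡.trans (cong (λ d → δ z x + (δ z y + d)) (degree-zip z xs ys (ℕ.suc-injective |xs|≡|ys|)))
          (shuffle (δ z x) (δ z y) (occurrences z xs) (occurrences z ys))
  where
  shuffle : ∀ a b c d → a + (b + (c + d)) ≡ (a + c) + (b + d)
  shuffle = solve-∀

All-zip : ∀ {P Q : Fin m → Set p} → All P xs → All Q ys → All (λ (x , y) → P x × Q y) (zip xs ys)
All-zip []         _          = []
All-zip (_ ∷ _)    []         = []
All-zip (px ∷ pxs) (qy ∷ qys) = (px , qy) ∷ All-zip pxs qys

module Vanishing {c ℓ} (K : CharZeroField c ℓ) (n : ℕ)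
  (τ : Subset (n + n) → CharZeroField.Carrier K)
  (orthogonal-sums≈0 : ∀ ν → CharZeroField._≈_ K (sumOrth K n τ ν) (CharZeroField.0# K))
  where
  open CharZeroField K using (Carrier; _≈_; 0#; setoid; sym) renaming (_+_ to _⊕_)
  open SubsetSums K
  open CharZeroFieldProperties K
  open import Relation.Binary.Reasoning.Setoid setoid

  Admissible : List (Edge (n + n)) → List (Edge (n + n)) → Subset (n + n) → Set
  Admissible M L R = IsHorizontal n R × All (Separates R) M × Coherent R L

  admissible? : ∀ M L → Decidable (Admissible M L)
  admissible? M L R = isHorizontal? n R ×-dec all? (separates? R) M ×-dec coherent? R L

  coherentSum : List (Edge (n + n)) → List (Edge (n + n)) → Carrier
  coherentSum M L = sumWhere K (admissible? M L) τ

  coherentSum-[] : ∀ M → IsPerfectMatching M → coherentSum M [] ≈ 0#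
  coherentSum-[] M perfect = begin
    coherentSum M []
      ≡⟨ sumWhere-cong (admissible? M []) τ (λ R → isHorizontal? n R ×-dec orthogonal? n R ν)
                       (λ R → mk⇔ to from) ⟩
    sumOrth K n τ ν
      ≈⟨ orthogonal-sums≈0 ν ⟩
    0# ∎
    where
    ν : Vertical n
    ν = toVertical M perfect
    to : Admissible M [] R → IsHorizontal n R × Orthogonal n R ν
    to {R} (horizontal , separated , _) =
      horizontal , Equivalence.from (orthogonal⇔separates {n} M perfect R) separated
    from : IsHorizontal n R × Orthogonal n R ν → Admissible M [] R
    from {R} (horizontal , orthogonal) =
      horizontal , Equivalence.to (orthogonal⇔separates {n} M perfect R) orthogonal , inj₁ []

  coherentSum-[-] : ∀ M e → coherentSum M (e ∷ []) ≡ coherentSum (e ∷ M) []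
  coherentSum-[-] M e =
    sumWhere-cong (admissible? M (e ∷ [])) τ (admissible? (e ∷ M) []) (λ R → mk⇔ to from)
    where
    to : Admissible M (e ∷ []) R → Admissible (e ∷ M) [] R
    to (horizontal , separated , coherent) =
      horizontal , Equivalence.to (coherent-[-]⇔separates e) coherent ∷ separated , inj₁ []
    from : Admissible (e ∷ M) [] R → Admissible M (e ∷ []) R
    from (horizontal , separates ∷ separated , _) =
      horizontal , separated , Equivalence.from (coherent-[-]⇔separates e) separates

  coherentSum-split : ∀ x y e M L → coherentSum ((x , y) ∷ M) (e ∷ L) ≈
                      coherentSum M ((x , y) ∷ e ∷ L) ⊕ coherentSum M ((y , x) ∷ e ∷ L)
  coherentSum-split x y e M L =
    sumWhere-⊎ (admissible? ((x , y) ∷ M) (e ∷ L)) τ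
               (admissible? M ((x , y) ∷ e ∷ L)) (admissible? M ((y , x) ∷ e ∷ L))
               (λ R → mk⇔ to from) (λ R (_ , _ , c) (_ , _ , c′) → coherent-flip-disjoint e c c′)
    where
    to : Admissible ((x , y) ∷ M) (e ∷ L) R →
         Admissible M ((x , y) ∷ e ∷ L) R ⊎ Admissible M ((y , x) ∷ e ∷ L) R
    to (horizontal , separates ∷ separated , coherent) =
      Sum.map (λ c → horizontal , separated , c) (λ c → horizontal , separated , c)
              (separates-coherent separates coherent)
    from : Admissible M ((x , y) ∷ e ∷ L) R ⊎ Admissible M ((y , x) ∷ e ∷ L) R →
           Admissible ((x , y) ∷ M) (e ∷ L) R
    from (inj₁ (horizontal , separated , coherent)) =
      let separates , coherent′ = coherent-∷⁻ coherent
      in  horizontal , separates ∷ separated , coherent′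
    from (inj₂ (horizontal , separated , coherent)) =
      let separates , coherent′ = coherent-∷⁻ coherent
      in  horizontal , separates-sym separates ∷ separated , coherent′

  coherentSum-cross : ∀ M x y u v L →
                      coherentSum M ((x , y) ∷ (u , v) ∷ L) ≡ coherentSum M ((x , v) ∷ (u , y) ∷ L)
  coherentSum-cross M x y u v L =
    sumWhere-cong (admissible? M ((x , y) ∷ (u , v) ∷ L)) τ (admissible? M ((x , v) ∷ (u , y) ∷ L))
                  (λ R → mk⇔ cross cross)
    where
    cross : ∀ {y v} → Admissible M ((x , y) ∷ (u , v) ∷ L) R →
                      Admissible M ((x , v) ∷ (u , y) ∷ L) R
    cross (horizontal , separated , coherent) = horizontal , separated , coherent-cross coherent

  coherentSum-∷≈0 : ∀ L e M → (∀ z → degree z M + degree z (e ∷ L) ≡ 1) →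
                    coherentSum M (e ∷ L) ≈ 0#
  coherentSum-∷≈0 [] e M covers = begin
    coherentSum M (e ∷ []) ≡⟨ coherentSum-[-] M e ⟩
    coherentSum (e ∷ M) [] ≈⟨ coherentSum-[] (e ∷ M) (λ z → ≡.trans (≡.sym (ℕ.+-identityʳ _))
                                (≡.trans (degree-regroup z e M []) (covers z))) ⟩
    0#                     ∎
  coherentSum-∷≈0 ((c , d) ∷ L) (a , b) M covers = pairwise-sums≈0⇒≈0 A B C A+B≈0 A+C≈0 B+C≈0
    where
    A B C : Carrier
    A = coherentSum M ((a , b) ∷ (c , d) ∷ L)
    B = coherentSum M ((b , a) ∷ (c , d) ∷ L)
    C = coherentSum M ((d , a) ∷ (c , b) ∷ L)

    covers-after-moving : ∀ x y w →
      (∀ z → degree z ((x , y) ∷ (c , w) ∷ L) ≡ degree z ((a , b) ∷ (c , d) ∷ L)) →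
      ∀ z → degree z ((x , y) ∷ M) + degree z ((c , w) ∷ L) ≡ 1
    covers-after-moving x y w same-degrees z = ≡.trans (degree-regroup z (x , y) M ((c , w) ∷ L))
      (≡.trans (cong (degree z M +_) (same-degrees z)) (covers z))

    A+B≈0 : A ⊕ B ≈ 0#
    A+B≈0 = begin
      A ⊕ B                                   ≈⟨ sym (coherentSum-split a b (c , d) M L) ⟩
      coherentSum ((a , b) ∷ M) ((c , d) ∷ L) ≈⟨ coherentSum-∷≈0 L (c , d) ((a , b) ∷ M)
                                                   (covers-after-moving a b d λ _ → ≡.refl) ⟩
      0#                                      ∎

    A+C≈0 : A ⊕ C ≈ 0#
    A+C≈0 = begin
      A ⊕ C                                   ≡⟨ cong (_⊕ C) (coherentSum-cross M a b c d L) ⟩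
      coherentSum M ((a , d) ∷ (c , b) ∷ L) ⊕ C ≈⟨ sym (coherentSum-split a d (c , b) M L) ⟩
      coherentSum ((a , d) ∷ M) ((c , b) ∷ L) ≈⟨ coherentSum-∷≈0 L (c , b) ((a , d) ∷ M)
                                                   (covers-after-moving a d b λ z → degree-cross z a d c b L) ⟩
      0#                                      ∎

    B+C≈0 : B ⊕ C ≈ 0#
    B+C≈0 = begin
      B ⊕ C
        ≡⟨ cong₂ _⊕_ (coherentSum-cross M b a c d L) (coherentSum-cross M d a c b L) ⟩
      coherentSum M ((b , d) ∷ (c , a) ∷ L) ⊕ coherentSum M ((d , b) ∷ (c , a) ∷ L)
        ≈⟨ sym (coherentSum-split b d (c , a) M L) ⟩
      coherentSum ((b , d) ∷ M) ((c , a) ∷ L)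
        ≈⟨ coherentSum-∷≈0 L (c , a) ((b , d) ∷ M) (covers-after-moving b d a λ z →
             ≡.trans (degree-cross z b d c a L) (degree-flip z b a ((c , d) ∷ L))) ⟩
      0# ∎

  coherentSum≈0 : ∀ L M → (∀ z → degree z M + degree z L ≡ 1) → coherentSum M L ≈ 0#
  coherentSum≈0 []      M covers =
    coherentSum-[] M (λ z → ≡.trans (≡.sym (ℕ.+-identityʳ _)) (covers z))
  coherentSum≈0 (e ∷ L) M covers = coherentSum-∷≈0 L e M covers

  τ≈0 : 1 ≤ n → ∀ R₀ → IsHorizontal n R₀ → τ R₀ ≈ 0#
  τ≈0 1≤n R₀ horizontal₀ = begin
    τ R₀
      ≈⟨ sym (sumWhere-single (admissible? [] L₀) τ R₀ λ R → mk⇔ (admissible⇒≡R₀ R) R≡R₀⇒admissible) ⟩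
    coherentSum [] L₀
      ≈⟨ coherentSum≈0 L₀ [] perfect₀ ⟩
    0# ∎
    where
    L₀ : List (Edge (n + n))
    L₀ = zip (members R₀) (members (∁ R₀))

    |∁R₀|≡n : ∣ ∁ R₀ ∣ ≡ n
    |∁R₀|≡n = ≡.trans (∣∁p∣≡n∸∣p∣ R₀)
                (≡.trans (cong (n + n ∸_) (proj₁ horizontal₀)) (ℕ.m+n∸m≡n n n))

    perfect₀ : IsPerfectMatching L₀
    perfect₀ z = ≡.trans (degree-zip z (members R₀) (members (∁ R₀)) equal-lengths)
                         (occurrences-members R₀ z)
      where
      equal-lengths : length (members R₀) ≡ length (members (∁ R₀))
      equal-lengths = ≡.trans (length-members R₀) (≡.trans (proj₁ horizontal₀) (≡.sym
                        (≡.trans (length-members (∁ R₀)) |∁R₀|≡n)))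

    oriented₀ : All (Oriented R₀) L₀
    oriented₀ = All-zip (members-⊆ R₀) (All.map x∈∁p⇒x∉p (members-⊆ (∁ R₀)))

    open PerfectMatching L₀ perfect₀ using (partner; adjacent-partner)

    0<n+n : 0 < n + n
    0<n+n = ℕ.≤-trans 1≤n (ℕ.m≤m+n n n)

    i₀ : Fin (n + n)
    i₀ = fromℕ< 0<n+n

    toℕi₀≡0 : toℕ i₀ ≡ 0
    toℕi₀≡0 = toℕ-fromℕ< 0<n+n

    admissible⇒≡R₀ : ∀ R → Admissible [] L₀ R → R ≡ R₀
    admissible⇒≡R₀ R (_ , [] , inj₁ oriented) =
      ⊆-antisym (oriented-⊆ spanning oriented oriented₀) (oriented-⊆ spanning oriented₀ oriented)
      where
      spanning : ∀ z → Σ[ w ∈ Fin (n + n) ] Adjacent L₀ z w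
      spanning z = partner z , adjacent-partner z
    admissible⇒≡R₀ R (horizontal , [] , inj₂ oriented) =
      contradiction (proj₂ horizontal i₀ toℕi₀≡0)
        (oriented-opposite (adjacent-partner i₀) oriented₀ oriented (proj₂ horizontal₀ i₀ toℕi₀≡0))

    R≡R₀⇒admissible : ∀ {R} → R ≡ R₀ → Admissible [] L₀ R
    R≡R₀⇒admissible ≡.refl = horizontal₀ , [] , inj₁ oriented₀

theorem2p4 : ∀ {c ℓ} (K : CharZeroField c ℓ) (n : ℕ) → 1 ≤ n →
    (τ : Subset (n + n) → CharZeroField.Carrier K) →
    (∀ (ν : Vertical n) → CharZeroField._≈_ K (sumOrth K n τ ν) (CharZeroField.0# K)) →
    ∀ (a : ℕ) → n ≤ 2 * a → a ≤ n →
    CharZeroField._≈_ K (sumType K n a τ) (CharZeroField.0# K)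
theorem2p4 K n 1≤n τ orthogonal-sums≈0 a _ _ =
  sumWhere-zero (λ R → isHorizontal? n R ×-dec hasType? n a R) τ
                λ R (horizontal , _) → τ≈0 1≤n R horizontal
  where
  open SubsetSums K
  open Vanishing K n τ orthogonal-sums≈0
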